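{- The Boolean query EVEN is not definable in $\exists^{\log^\omega}\mathrm{IFP}$: there is no sentence $\phi$ of $\exists^{\log^\omega}\mathrm{IFP}[\{E\}]$ such that for every finite graph $\mathcal G$ (with vertex set $V$), $\mathcal G\models\phi$ iff $|V|$ is even.
   Context: Graphs are finite structures over the signature $\{E\}$ with $E$ binary (no built-in order). $\log(n)=\lceil\log_2 n\rceil$, $\log^k(n)=(\log(n))^k$. IFP is first-order logic extended by the inflationary fixed-point operator. For $k>0$, $\exists^{\log^k}$ is the second-order quantifier with semantics $\mathscr A\models\exists^{\log^k}X\phi$ iff there is $S\subseteq A^{\mathrm{arity}(X)}$ with $|S|\le\log^k(|A|)$ such that $\mathscr A\models\phi[X/S]$. Formulas of $\exists^{\log^\omega}\mathrm{IFP}$ have the form $\exists^{\log^{k_1}}X_1\cdots\exists^{\log^{k_m}}X_m\psi$ with $m\ge0$, $k_i>0$ and $\psi$ an IFP-formula. -}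

module Defs where

open import Data.Nat using (ℕ; zero; suc; _+_; _^_; _≤_; _<_)
open import Data.Nat.Logarithm using (⌈log₂_⌉)
open import Data.Bool using (Bool; true; false; _∧_; _∨_; not; T)
open import Data.Bool.ListAction using (any; all)
open import Data.Fin using (Fin; splitAt; _≟_)
open import Data.List as List using (List; []; _∷_; length; concatMap; filterᵇ; allFin)
open import Data.Vec as Vec using (Vec; []; _∷_)
open import Data.Sum using ([_,_]′)
open import Data.Product using (Σ; _×_)
open import Relation.Nullary.Decidable using (⌊_⌋)
open import Relation.Binary.PropositionalEquality using (_≡_)

logᵏ : ℕ → ℕ → ℕ
logᵏ k n = ⌈log₂ n ⌉ ^ k

-- Syntax of IFP over the signature {E}.
-- Γ : arities of the free relation (second-order / fixed-point) variables,
-- m : number of free first-order variables (de Bruijn, Fin m).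

data Formula (Γ : List ℕ) (m : ℕ) : Set where
  edge  : Fin m → Fin m → Formula Γ m
  equal : Fin m → Fin m → Formula Γ m
  rel   : (i : Fin (length Γ)) → Vec (Fin m) (List.lookup Γ i) → Formula Γ m
  neg   : Formula Γ m → Formula Γ m
  conj  : Formula Γ m → Formula Γ m → Formula Γ m
  disj  : Formula Γ m → Formula Γ m → Formula Γ m
  exi   : Formula Γ (suc m) → Formula Γ m
  all'  : Formula Γ (suc m) → Formula Γ m
  -- [ifp_{R, x₁…x_k} φ](t̄) : φ has the new relation variable R (index 0) of
  -- arity k and the new first-order variables x₁…x_k (the first k of k + m);
  -- the remaining m variables are parameters.
  ifp   : (k : ℕ) → Formula (k ∷ Γ) (k + m) → Vec (Fin m) k → Formula Γ m

-- Second-order prefix ∃^{log^{k₁}} X₁ ⋯ ∃^{log^{k_m}} X_m ψ  (each k > 0)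
data LogSOFormula (Γ : List ℕ) : Set where
  body   : Formula Γ 0 → LogSOFormula Γ
  ∃log   : (arity k : ℕ) → 0 < k → LogSOFormula (arity ∷ Γ) → LogSOFormula Γ

Sentence : Set
Sentence = LogSOFormula []

Graph : ℕ → Set
Graph N = Fin N → Fin N → Bool

Rel : ℕ → ℕ → Set
Rel N k = Vec (Fin N) k → Bool

RelEnv : ℕ → List ℕ → Set
RelEnv N Γ = (i : Fin (length Γ)) → Rel N (List.lookup Γ i)

extR : ∀ {N k Γ} → Rel N k → RelEnv N Γ → RelEnv N (k ∷ Γ)
extR R ρ Fin.zero = R
extR R ρ (Fin.suc i) = ρ i

extV : ∀ {N m} → Fin N → (Fin m → Fin N) → (Fin (suc m) → Fin N)
extV a σ Fin.zero = a
extV a σ (Fin.suc i) = σ i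

extVs : ∀ {N k m} → Vec (Fin N) k → (Fin m → Fin N) → (Fin (k + m) → Fin N)
extVs {k = k} as σ i = [ Vec.lookup as , σ ]′ (splitAt k i)

iterate : ∀ {A : Set} → (A → A) → ℕ → A → A
iterate f zero a = a
iterate f (suc n) a = f (iterate f n a)

eval : ∀ {N Γ m} → Graph N → Formula Γ m → RelEnv N Γ → (Fin m → Fin N) → Bool
eval G (edge x y)  ρ σ = G (σ x) (σ y)
eval G (equal x y) ρ σ = ⌊ σ x ≟ σ y ⌋
eval G (rel i xs)  ρ σ = ρ i (Vec.map σ xs)
eval G (neg φ)     ρ σ = not (eval G φ ρ σ)
eval G (conj φ ψ)  ρ σ = eval G φ ρ σ ∧ eval G ψ ρ σ
eval G (disj φ ψ)  ρ σ = eval G φ ρ σ ∨ eval G ψ ρ σ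
eval {N} G (exi φ)  ρ σ = any (λ a → eval G φ ρ (extV a σ)) (allFin N)
eval {N} G (all' φ) ρ σ = all (λ a → eval G φ ρ (extV a σ)) (allFin N)
eval {N} G (ifp k φ ts) ρ σ = stages (N ^ k) (λ _ → false) (Vec.map σ ts)
  where
  -- inflationary stage: R ↦ R ∪ {ā | φ(R, ā)}.  Stages grow, so after
  -- N^k steps (the number of k-tuples) the fixed point has been reached.
  step : Rel N k → Rel N k
  step R as = R as ∨ eval G φ (extR R ρ) (extVs as σ)
  stages : ℕ → Rel N k → Rel N k
  stages n R = iterate step n R

allTuples : (N k : ℕ) → List (Vec (Fin N) k)
allTuples N zero = [] ∷ []
allTuples N (suc k) = concatMap (λ a → List.map (a ∷_) (allTuples N k)) (allFin N)

card : ∀ {N k} → Rel N k → ℕ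
card {N} {k} S = length (filterᵇ S (allTuples N k))

Sat : ∀ {N Γ} → Graph N → LogSOFormula Γ → RelEnv N Γ → Set
Sat G (body ψ) ρ = T (eval G ψ ρ (λ ()))
Sat {N} G (∃log ar k _ φ) ρ =
  Σ (Rel N ar) λ S → card S ≤ logᵏ k N × Sat G φ (extR S ρ)

_⊨_ : ∀ {N} → Graph N → Sentence → Set
G ⊨ φ = Sat G φ (λ ())

-- Embed the empty graph on N vertices into the one on N + 1 via suc, the new vertex being zero.
-- A guessed relation S is transferred along this embedding; it mentions at most
-- arity · log^k N vertices, collected in a list C. An Ehrenfeucht–Fraïssé back-and-forth argument
-- shows that an IFP formula with w variables cannot distinguish assignments related by a partial
-- bijection extending c ↦ suc c on C, as long as |C| + w < N: first-order quantifiers are answered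
-- move by move, and the fixed-point stages correspond stage by stage and are stable after N^k
-- steps. The number |C| + w grows only polylogarithmically in N, so some N = 2^t is large enough;
-- the sentence then holds on N + 1 vertices as soon as it holds on N, although exactly one of
-- them is even.
module Submission where

open import Defs
open import Data.Bool using (Bool; true; false; _∧_; _∨_; not; T; T?)
open import Data.Bool.ListAction using (any; all; or; and)
open import Data.Bool.Properties using (T-∨)
open import Data.Empty using (⊥-elim)
open import Data.Fin as Fin using (Fin; zero; suc; splitAt; _↑ˡ_; _↑ʳ_)
open import Data.Fin.Properties as Finₚ using (splitAt-↑ˡ; splitAt-↑ʳ; splitAt⁻¹-↑ˡ; splitAt⁻¹-↑ʳ)
open import Data.List as List using (List; []; _∷_; _++_; length; concatMap; filterᵇ; allFin)
open import Data.List.Membership.Propositional using (_∈_; _∉_; find; lose)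
open import Data.List.Membership.Propositional.Properties
  using (∈-map⁺; ∈-map⁻; ∈-++⁺ˡ; ∈-++⁺ʳ; ∈-allFin; ∈-concatMap⁺; ∈-filter⁺; ∈-tabulate⁺)
open import Data.List.Properties
  using (length-++; length-map; filter-++; map-cong; map-∘; map-tabulate; length-tabulate; length-filter)
open import Data.List.Relation.Unary.Any using (here; there; any?)
open import Data.List.Relation.Unary.Any.Properties using (any⁺; any⁻)
open import Data.Nat using (ℕ; zero; suc; _+_; _*_; _∸_; _⊔_; _^_; _≤_; _<_; z≤n; s≤s; NonZero; >-nonZero)
open import Data.Nat.Divisibility using (_∣_; divides; ∣m+n∣m⇒∣n; ∣⇒≤)
open import Data.Nat.ListAction using (sum)
open import Data.Nat.Logarithm using (⌈log₂_⌉; ⌈log₂⌉-mono-≤; ⌈log₂2^n⌉≡n)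
open import Data.Nat.Properties
open import Data.Product using (Σ; ∃; _×_; _,_; proj₁; proj₂; map₂)
open import Data.Sum using (_⊎_; inj₁; inj₂; [_,_]′)
open import Data.Vec as Vec using (Vec; []; _∷_)
open import Data.Vec.Membership.Propositional.Properties using (∈-toList⁺; ∈-lookup)
open import Data.Vec.Properties using (lookup-map; length-toList; tabulate∘lookup; tabulate-cong)
open import Function using (_∘_; const; _⇔_; Equivalence; mk⇔)
open import Relation.Binary.PropositionalEquality
open import Relation.Nullary using (¬_; ¬?; Dec; yes; no; _×-dec_)
open import Relation.Nullary.Decidable using (decidable-stable)

private variable
  A B : Set

T-ext : ∀ {b c} → (T b → T c) → (T c → T b) → b ≡ c
T-ext {false} {false} _ _ = refl
T-ext {false} {true}  _ g = ⊥-elim (g _)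
T-ext {true}  {false} f _ = ⊥-elim (f _)
T-ext {true}  {true}  _ _ = refl

count : (A → Bool) → List A → ℕ
count p xs = length (filterᵇ p xs)

count-++ : ∀ (p : A → Bool) xs ys → count p (xs ++ ys) ≡ count p xs + count p ys
count-++ p xs ys = trans (cong length (filter-++ _ xs ys)) (length-++ (filterᵇ p xs))

count-concatMap : ∀ (p : A → Bool) (f : B → List A) xs →
                  count p (concatMap f xs) ≡ sum (List.map (count p ∘ f) xs)
count-concatMap p f []       = refl
count-concatMap p f (x ∷ xs) =
  trans (count-++ p (f x) (concatMap f xs)) (cong (count p (f x) +_) (count-concatMap p f xs))

count-map : ∀ (p : A → Bool) (f : B → A) xs → count p (List.map f xs) ≡ count (p ∘ f) xs
count-map p f [] = refl
count-map p f (x ∷ xs) with p (f x)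
... | true  = cong suc (count-map p f xs)
... | false = count-map p f xs

count-false : ∀ (xs : List A) → count (λ _ → false) xs ≡ 0
count-false []       = refl
count-false (x ∷ xs) = count-false xs

count-mono : ∀ {p q : A → Bool} → (∀ x → T (p x) → T (q x)) → ∀ xs → count p xs ≤ count q xs
count-mono p⊆q [] = z≤n
count-mono {p = p} {q} p⊆q (x ∷ xs) with p x | q x | p⊆q x
... | true  | true  | _     = s≤s (count-mono p⊆q xs)
... | true  | false | px⇒qx = ⊥-elim (px⇒qx _)
... | false | true  | _     = m≤n⇒m≤1+n (count-mono p⊆q xs)
... | false | false | _     = count-mono p⊆q xs

count-mono-< : ∀ {p q : A → Bool} → (∀ x → T (p x) → T (q x)) →
               ∀ {y xs} → y ∈ xs → ¬ T (p y) → T (q y) → count p xs < count q xs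
count-mono-< {p = p} {q} p⊆q {xs = x ∷ xs} (here refl) ¬py qy with p x | q x
... | false | true  = s≤s (count-mono p⊆q xs)
... | true  | _     = ⊥-elim (¬py _)
count-mono-< {p = p} {q} p⊆q {xs = x ∷ xs} (there y∈xs) ¬py qy with p x | q x | p⊆q x
... | true  | true  | _     = s≤s (count-mono-< p⊆q y∈xs ¬py qy)
... | true  | false | px⇒qx = ⊥-elim (px⇒qx _)
... | false | true  | _     = m≤n⇒m≤1+n (count-mono-< p⊆q y∈xs ¬py qy)
... | false | false | _     = count-mono-< p⊆q y∈xs ¬py qy

any-witness : ∀ (f : A → Bool) xs → T (any f xs) → ∃ λ x → x ∈ xs × T (f x)
any-witness f xs = find ∘ any⁻ f xs

any-intro : ∀ (f : A → Bool) {x xs} → x ∈ xs → T (f x) → T (any f xs)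
any-intro f x∈xs fx = any⁺ f (lose x∈xs fx)

all≡not-any-not : ∀ (f : A → Bool) xs → all f xs ≡ not (any (not ∘ f) xs)
all≡not-any-not f []       = refl
all≡not-any-not f (x ∷ xs) with f x
... | true  = all≡not-any-not f xs
... | false = refl

any-≡ : ∀ (f : A → Bool) (g : B → Bool) {xs ys} →
        (∀ {x} → x ∈ xs → ∃ λ y → y ∈ ys × f x ≡ g y) →
        (∀ {y} → y ∈ ys → ∃ λ x → x ∈ xs × f x ≡ g y) →
        any f xs ≡ any g ys
any-≡ f g {xs} {ys} forth back = T-ext to from
  where
  to : T (any f xs) → T (any g ys)
  to fxs with any-witness f xs fxs
  ... | x , x∈xs , fx with forth x∈xs
  ... | y , y∈ys , fx≡gy = any-intro g y∈ys (subst T fx≡gy fx)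
  from : T (any g ys) → T (any f xs)
  from gys with any-witness g ys gys
  ... | y , y∈ys , gy with back y∈ys
  ... | x , x∈xs , fx≡gy = any-intro f x∈xs (subst T (sym fx≡gy) gy)

all-≡ : ∀ (f : A → Bool) (g : B → Bool) {xs ys} →
        (∀ {x} → x ∈ xs → ∃ λ y → y ∈ ys × f x ≡ g y) →
        (∀ {y} → y ∈ ys → ∃ λ x → x ∈ xs × f x ≡ g y) →
        all f xs ≡ all g ys
all-≡ f g {xs} {ys} forth back = begin
  all f xs
    ≡⟨ all≡not-any-not f xs ⟩
  not (any (not ∘ f) xs)
    ≡⟨ cong not (any-≡ (not ∘ f) (not ∘ g) (map₂ (map₂ (cong not)) ∘ forth) (map₂ (map₂ (cong not)) ∘ back)) ⟩
  not (any (not ∘ g) ys)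
    ≡⟨ all≡not-any-not g ys ⟨
  all g ys
    ∎
  where
  open ≡-Reasoning

lookup-ext : ∀ {k} {xs ys : Vec A k} → (∀ i → Vec.lookup xs i ≡ Vec.lookup ys i) → xs ≡ ys
lookup-ext {xs = xs} {ys} xs≗ys = trans (sym (tabulate∘lookup xs)) (trans (tabulate-cong xs≗ys) (tabulate∘lookup ys))

length-concatMap-const : ∀ {f : A → List B} {c} → (∀ x → length (f x) ≡ c) →
                         ∀ xs → length (concatMap f xs) ≡ length xs * c
length-concatMap-const         fx≡c []       = refl
length-concatMap-const {f = f} fx≡c (x ∷ xs) =
  trans (length-++ (f x)) (cong₂ _+_ (fx≡c x) (length-concatMap-const fx≡c xs))

allFin-suc : ∀ N → allFin (suc N) ≡ zero ∷ List.map suc (allFin N)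
allFin-suc N = cong (zero ∷_) (sym (map-tabulate (λ i → i) suc))

∈-allTuples : ∀ {N k} (as : Vec (Fin N) k) → as ∈ allTuples N k
∈-allTuples []       = here refl
∈-allTuples {N} {suc k} (a ∷ as) =
  ∈-concatMap⁺ (λ a → List.map (a ∷_) (allTuples N k)) (lose (∈-allFin a) (∈-map⁺ (a ∷_) (∈-allTuples as)))

length-allTuples : ∀ N k → length (allTuples N k) ≡ N ^ k
length-allTuples N zero    = refl
length-allTuples N (suc k) = begin
  length (concatMap (λ a → List.map (a ∷_) (allTuples N k)) (allFin N))
    ≡⟨ length-concatMap-const (λ a → trans (length-map (a ∷_) (allTuples N k)) (length-allTuples N k)) (allFin N) ⟩
  length (allFin N) * N ^ k
    ≡⟨ cong (_* N ^ k) (length-tabulate {n = N} (λ i → i)) ⟩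
  N * N ^ k
    ∎
  where open ≡-Reasoning

card-∷ : ∀ {N k} (R : Rel N (suc k)) → card R ≡ sum (List.map (λ a → card (λ as → R (a ∷ as))) (allFin N))
card-∷ {N} {k} R = begin
  card R
    ≡⟨ count-concatMap R (λ a → List.map (a ∷_) (allTuples N k)) (allFin N) ⟩
  sum (List.map (λ a → count R (List.map (a ∷_) (allTuples N k))) (allFin N))
    ≡⟨ cong sum (map-cong (λ a → count-map R (a ∷_) (allTuples N k)) (allFin N)) ⟩
  sum (List.map (λ a → card (λ as → R (a ∷ as))) (allFin N))
    ∎
  where open ≡-Reasoning

liftRel : ∀ {N k} → Rel N k → Rel (suc N) k
liftRel {k = zero}  S []           = S []
liftRel {k = suc k} S (zero  ∷ bs) = false
liftRel {k = suc k} S (suc a ∷ bs) = liftRel (λ as → S (a ∷ as)) bs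

liftRel-map-suc : ∀ {N k} (S : Rel N k) as → liftRel S (Vec.map suc as) ≡ S as
liftRel-map-suc S []       = refl
liftRel-map-suc S (a ∷ as) = liftRel-map-suc (λ as → S (a ∷ as)) as

liftRel⁻ : ∀ {N k} (S : Rel N k) bs → T (liftRel S bs) → ∃ λ as → bs ≡ Vec.map suc as × T (S as)
liftRel⁻ S []           Sbs = [] , refl , Sbs
liftRel⁻ S (suc b ∷ bs) Sbs with liftRel⁻ (λ as → S (b ∷ as)) bs Sbs
... | as , refl , Sas = b ∷ as , refl , Sas

card-liftRel : ∀ {N k} (S : Rel N k) → card (liftRel S) ≡ card S
card-liftRel {k = zero} S with S []
... | true  = refl
... | false = refl
card-liftRel {N} {suc k} S = begin
  card (liftRel S)
    ≡⟨ card-∷ (liftRel S) ⟩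
  sum (List.map (λ b → card (λ bs → liftRel S (b ∷ bs))) (allFin (suc N)))
    ≡⟨ cong (sum ∘ List.map _) (allFin-suc N) ⟩
  count (λ _ → false) (allTuples (suc N) k)
    + sum (List.map (λ b → card (λ bs → liftRel S (b ∷ bs))) (List.map suc (allFin N)))
    ≡⟨ cong₂ _+_ (count-false (allTuples (suc N) k)) (cong sum (sym (map-∘ (allFin N)))) ⟩
  sum (List.map (λ a → card (liftRel (λ as → S (a ∷ as)))) (allFin N))
    ≡⟨ cong sum (map-cong (λ a → card-liftRel (λ as → S (a ∷ as))) (allFin N)) ⟩
  sum (List.map (λ a → card (λ as → S (a ∷ as))) (allFin N))
    ≡⟨ card-∷ S ⟨
  card S
    ∎
  where open ≡-Reasoning

support : ∀ {N k} → Rel N k → List (Fin N)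
support {N} {k} S = concatMap Vec.toList (filterᵇ S (allTuples N k))

length-support : ∀ {N k} (S : Rel N k) → length (support S) ≡ card S * k
length-support {N} {k} S = length-concatMap-const length-toList (filterᵇ S (allTuples N k))

∈-support : ∀ {N k} (S : Rel N k) {as} → T (S as) → ∀ i → Vec.lookup as i ∈ support S
∈-support {N} {k} S {as} Sas i =
  ∈-concatMap⁺ Vec.toList (lose (∈-filter⁺ (T? ∘ S) (∈-allTuples as) Sas) (∈-toList⁺ (∈-lookup i as)))

module InflationaryStages {A : Set} (xs : List A) (complete : ∀ a → a ∈ xs)
  (step : (A → Bool) → A → Bool)
  (inflationary : ∀ R a → T (R a) → T (step R a))
  (step-≗ : ∀ {R R′} → (∀ a → R a ≡ R′ a) → ∀ a → step R a ≡ step R′ a) where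

  stage : ℕ → A → Bool
  stage n = iterate step n (λ _ → false)

  Stable : ℕ → Set
  Stable n = ∀ a → stage n a ≡ stage (suc n) a

  stable-forever : ∀ {n} → Stable n → ∀ i a → stage n a ≡ stage (i + n) a
  stable-forever s zero    a = refl
  stable-forever s (suc i) a = trans (s a) (step-≗ (stable-forever s i) a)

  -- Until the stages become stable, each one adds an element of xs.
  stable-or-large : ∀ n → (∃ λ j → j < n × Stable j) ⊎ n ≤ count (stage n) xs
  stable-or-large zero = inj₂ z≤n
  stable-or-large (suc n) with stable-or-large n
  ... | inj₁ (j , j<n , s) = inj₁ (j , m≤n⇒m≤1+n j<n , s)
  ... | inj₂ n≤c with any? (λ a → ¬? (T? (stage n a)) ×-dec T? (stage (suc n) a)) xs
  ...   | yes some with find some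
  ...     | a , a∈xs , absent , present =
    inj₂ (≤-trans (s≤s n≤c) (count-mono-< (inflationary (stage n)) a∈xs absent present))
  stable-or-large (suc n) | inj₂ n≤c | no none =
    inj₁ (n , ≤-refl , λ a → T-ext (inflationary (stage n) a) (λ present →
      decidable-stable (T? (stage n a)) (λ absent → none (lose (complete a) (absent , present)))))

  stabilises : ∀ {L n} → length xs ≤ L → L ≤ n → ∀ a → stage L a ≡ stage n a
  stabilises {L} {n} |xs|≤L L≤n a with stable-or-large (suc (length xs))
  ... | inj₂ large = ⊥-elim (<⇒≱ large (length-filter (T? ∘ stage (suc (length xs))) xs))
  ... | inj₁ (j , s≤s j≤|xs| , s) = trans (sym (reach (≤-trans j≤|xs| |xs|≤L))) (reach (≤-trans j≤|xs| (≤-trans |xs|≤L L≤n)))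
    where
    reach : ∀ {m} → j ≤ m → stage j a ≡ stage m a
    reach {m} j≤m = trans (stable-forever s (m ∸ j) a) (cong (λ i → stage i a) (m∸n+n≡m j≤m))

extR-≗ : ∀ {N k Γ} {R R′ : Rel N k} {ρ ρ′ : RelEnv N Γ} →
         (∀ as → R as ≡ R′ as) → (∀ i as → ρ i as ≡ ρ′ i as) →
         ∀ i as → extR {Γ = Γ} R ρ i as ≡ extR {Γ = Γ} R′ ρ′ i as
extR-≗ R≗R′ ρ≗ρ′ zero    = R≗R′
extR-≗ R≗R′ ρ≗ρ′ (suc i) = ρ≗ρ′ i

ifpStep : ∀ {N Γ m k} → Graph N → Formula (k ∷ Γ) (k + m) → RelEnv N Γ → (Fin m → Fin N) → Rel N k → Rel N k
ifpStep G φ ρ σ R as = R as ∨ eval G φ (extR R ρ) (extVs as σ)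

eval-≗ : ∀ {N Γ m} (G : Graph N) (φ : Formula Γ m) {ρ ρ′ : RelEnv N Γ} → (∀ i as → ρ i as ≡ ρ′ i as) →
         ∀ σ → eval G φ ρ σ ≡ eval G φ ρ′ σ
eval-≗ G (edge x y)  ρ≗ρ′ σ = refl
eval-≗ G (equal x y) ρ≗ρ′ σ = refl
eval-≗ G (rel i xs)  ρ≗ρ′ σ = ρ≗ρ′ i (Vec.map σ xs)
eval-≗ G (neg φ)     ρ≗ρ′ σ = cong not (eval-≗ G φ ρ≗ρ′ σ)
eval-≗ G (conj φ ψ)  ρ≗ρ′ σ = cong₂ _∧_ (eval-≗ G φ ρ≗ρ′ σ) (eval-≗ G ψ ρ≗ρ′ σ)
eval-≗ G (disj φ ψ)  ρ≗ρ′ σ = cong₂ _∨_ (eval-≗ G φ ρ≗ρ′ σ) (eval-≗ G ψ ρ≗ρ′ σ)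
eval-≗ {N} G (exi φ)  ρ≗ρ′ σ = cong or  (map-cong (λ a → eval-≗ G φ ρ≗ρ′ (extV a σ)) (allFin N))
eval-≗ {N} G (all' φ) ρ≗ρ′ σ = cong and (map-cong (λ a → eval-≗ G φ ρ≗ρ′ (extV a σ)) (allFin N))
eval-≗ {N} {Γ} G (ifp k φ ts) {ρ} {ρ′} ρ≗ρ′ σ = stages-≗ (N ^ k) (Vec.map σ ts)
  where
  stages-≗ : ∀ n as → iterate (ifpStep G φ ρ σ) n (λ _ → false) as
                    ≡ iterate (ifpStep G φ ρ′ σ) n (λ _ → false) as
  stages-≗ zero    as = refl
  stages-≗ (suc n) as = cong₂ _∨_ (stages-≗ n as) (eval-≗ G φ (extR-≗ {Γ = Γ} (stages-≗ n) ρ≗ρ′) (extVs as σ))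

ifpStep-inflationary : ∀ {N Γ m k} (G : Graph N) (φ : Formula (k ∷ Γ) (k + m)) ρ σ R as →
                       T (R as) → T (ifpStep G φ ρ σ R as)
ifpStep-inflationary G φ ρ σ R as = Equivalence.from T-∨ ∘ inj₁

ifpStep-≗ : ∀ {N Γ m k} (G : Graph N) (φ : Formula (k ∷ Γ) (k + m)) ρ σ {R R′ : Rel N k} →
            (∀ as → R as ≡ R′ as) → ∀ as → ifpStep G φ ρ σ R as ≡ ifpStep G φ ρ σ R′ as
ifpStep-≗ {Γ = Γ} G φ ρ σ R≗R′ as = cong₂ _∨_ (R≗R′ as) (eval-≗ G φ (extR-≗ {Γ = Γ} R≗R′ (λ _ _ → refl)) (extVs as σ))

eval-ifp-stable : ∀ {N Γ m k} (G : Graph N) (φ : Formula (k ∷ Γ) (k + m)) ts ρ σ {n} → N ^ k ≤ n →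
                  eval G (ifp k φ ts) ρ σ ≡ iterate (ifpStep G φ ρ σ) n (λ _ → false) (Vec.map σ ts)
eval-ifp-stable {N} {k = k} G φ ts ρ σ N^k≤n =
  Stages.stabilises (≤-reflexive (length-allTuples N k)) N^k≤n (Vec.map σ ts)
  where
  module Stages = InflationaryStages (allTuples N k) ∈-allTuples (ifpStep G φ ρ σ)
                                     (ifpStep-inflationary G φ ρ σ) (ifpStep-≗ G φ ρ σ)

data SplitView (k : ℕ) {m : ℕ} : Fin (k + m) → Set where
  left  : ∀ j → SplitView k (j ↑ˡ m)
  right : ∀ j → SplitView k (k ↑ʳ j)

splitView : ∀ k {m} (i : Fin (k + m)) → SplitView k i
splitView k i with splitAt k i in eq
... | inj₁ j rewrite sym (splitAt⁻¹-↑ˡ eq) = left j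
... | inj₂ j rewrite sym (splitAt⁻¹-↑ʳ eq) = right j

extVs-↑ˡ : ∀ {N k m} (as : Vec (Fin N) k) (σ : Fin m → Fin N) j → extVs as σ (j ↑ˡ m) ≡ Vec.lookup as j
extVs-↑ˡ {k = k} {m} as σ j = cong [ Vec.lookup as , σ ]′ (splitAt-↑ˡ k j m)

extVs-↑ʳ : ∀ {N k m} (as : Vec (Fin N) k) (σ : Fin m → Fin N) j → extVs as σ (k ↑ʳ j) ≡ σ j
extVs-↑ʳ {k = k} {m} as σ j = cong [ Vec.lookup as , σ ]′ (splitAt-↑ʳ k m j)

absurd⇔ : ∀ {P Q : Set} → ¬ P → ¬ Q → P ⇔ Q
absurd⇔ ¬p ¬q = mk⇔ (⊥-elim ∘ ¬p) (⊥-elim ∘ ¬q)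

∈-map-≡ : ∀ {f : A → B} {x y xs} → x ∈ xs → y ≡ f x → y ∈ List.map f xs
∈-map-≡ x∈xs refl = ∈-map⁺ _ x∈xs

∈-tabulate-≡ : ∀ {k} {f : Fin k → A} {x} j → x ≡ f j → x ∈ List.tabulate f
∈-tabulate-≡ j refl = ∈-tabulate⁺ j

predecessors : ∀ {M} → List (Fin (suc M)) → List (Fin M)
predecessors []           = []
predecessors (zero  ∷ xs) = predecessors xs
predecessors (suc a ∷ xs) = a ∷ predecessors xs

length-predecessors : ∀ {M} (xs : List (Fin (suc M))) → length (predecessors xs) ≤ length xs
length-predecessors []           = z≤n
length-predecessors (zero  ∷ xs) = m≤n⇒m≤1+n (length-predecessors xs)
length-predecessors (suc a ∷ xs) = s≤s (length-predecessors xs)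

length-predecessors-< : ∀ {M} {xs : List (Fin (suc M))} → zero ∈ xs → length (predecessors xs) < length xs
length-predecessors-< {xs = zero  ∷ xs} (here refl) = s≤s (length-predecessors xs)
length-predecessors-< {xs = zero  ∷ xs} (there 0∈xs) = s≤s (length-predecessors xs)
length-predecessors-< {xs = suc a ∷ xs} (there 0∈xs) = s≤s (length-predecessors-< 0∈xs)

∈-predecessors : ∀ {M} {a : Fin M} {xs} → suc a ∈ xs → a ∈ predecessors xs
∈-predecessors {xs = suc b ∷ xs} (here refl)    = here refl
∈-predecessors {xs = zero  ∷ xs} (there sa∈xs) = ∈-predecessors sa∈xs
∈-predecessors {xs = suc b ∷ xs} (there sa∈xs) = there (∈-predecessors sa∈xs)

_∈?_ : ∀ {M} (a : Fin M) xs → Dec (a ∈ xs)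
a ∈? xs = any? (a Fin.≟_) xs

fresh : ∀ M (xs : List (Fin M)) → length xs < M → ∃ λ a → a ∉ xs
fresh (suc M) xs |xs|<M with zero ∈? xs
... | no 0∉xs  = zero , 0∉xs
... | yes 0∈xs with fresh M (predecessors xs) (≤-trans (length-predecessors-< 0∈xs) (≤-pred |xs|<M))
...   | a , a∉ = suc a , a∉ ∘ ∈-predecessors

module _ {N : ℕ} where

  -- PartialIso C σ σ′: the assignment σ i ↦ σ′ i, together with c ↦ suc c for c ∈ C, is a
  -- well-defined injective partial map, hence a partial isomorphism between the empty graphs.
  Compatible : List (Fin N) → Fin N → Fin (suc N) → Set
  Compatible C a b = (a ∈ C → b ≡ suc a) × (∀ {c} → c ∈ C → b ≡ suc c → a ≡ c)

  PartialIso : ∀ {m} → List (Fin N) → (Fin m → Fin N) → (Fin m → Fin (suc N)) → Set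
  PartialIso C σ σ′ = (∀ i → Compatible C (σ i) (σ′ i)) × (∀ i j → σ i ≡ σ j ⇔ σ′ i ≡ σ′ j)

  Covered : ∀ {p q} → (Fin p → Fin N) → (Fin p → Fin (suc N)) → (Fin q → Fin N) → (Fin q → Fin (suc N)) → Set
  Covered σ σ′ τ τ′ = ∀ i → ∃ λ j → σ i ≡ τ j × σ′ i ≡ τ′ j

  PartialIso-covered : ∀ {C p q} {σ : Fin p → Fin N} {σ′} {τ : Fin q → Fin N} {τ′} →
                       Covered σ σ′ τ τ′ → PartialIso C τ τ′ → PartialIso C σ σ′
  PartialIso-covered {σ = σ} {σ′} cov (compatible , injective) = compatible′ , injective′
    where
    compatible′ : ∀ i → Compatible _ (σ i) (σ′ i)
    compatible′ i with cov i
    ... | j , e , e′ rewrite e | e′ = compatible j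
    injective′ : ∀ i i′ → σ i ≡ σ i′ ⇔ σ′ i ≡ σ′ i′
    injective′ i i′ with cov i | cov i′
    ... | j , e₁ , e₁′ | j′ , e₂ , e₂′ rewrite e₁ | e₁′ | e₂ | e₂′ = injective j j′

  PartialIso-⊆ : ∀ {C C′ m} {σ : Fin m → Fin N} {σ′} →
                 (∀ {c} → c ∈ C → c ∈ C′) → PartialIso C′ σ σ′ → PartialIso C σ σ′
  PartialIso-⊆ C⊆C′ (compatible , injective) =
    (λ i → proj₁ (compatible i) ∘ C⊆C′ , proj₂ (compatible i) ∘ C⊆C′) , injective

  RelIso : ∀ {m k} → List (Fin N) → (Fin m → Fin N) → (Fin m → Fin (suc N)) → Rel N k → Rel (suc N) k → Set
  RelIso C σ σ′ R R′ = ∀ as bs → PartialIso C (extVs as σ) (extVs bs σ′) → R as ≡ R′ bs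

  EnvIso : ∀ {m} → List (Fin N) → (Fin m → Fin N) → (Fin m → Fin (suc N)) →
           (Γ : List ℕ) → RelEnv N Γ → RelEnv (suc N) Γ → Set
  EnvIso C σ σ′ Γ ρ ρ′ = ∀ i → RelIso C σ σ′ (ρ i) (ρ′ i)

  covered-extVs : ∀ {k m m′} (as : Vec (Fin N) k) bs {σ : Fin m → Fin N} {σ′} {τ : Fin m′ → Fin N} {τ′} →
                  Covered σ σ′ τ τ′ → Covered (extVs as σ) (extVs bs σ′) (extVs as τ) (extVs bs τ′)
  covered-extVs {k} {m} {m′} as bs {σ} {σ′} {τ} {τ′} cov i with splitView k i
  ... | left j = j ↑ˡ m′ , trans (extVs-↑ˡ as σ j) (sym (extVs-↑ˡ as τ j))
                         , trans (extVs-↑ˡ bs σ′ j) (sym (extVs-↑ˡ bs τ′ j))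
  ... | right j with cov j
  ...   | j′ , e , e′ = k ↑ʳ j′ , trans (extVs-↑ʳ as σ j) (trans e (sym (extVs-↑ʳ as τ j′)))
                                , trans (extVs-↑ʳ bs σ′ j) (trans e′ (sym (extVs-↑ʳ bs τ′ j′)))

  covered-params : ∀ {k m} (as : Vec (Fin N) k) bs {σ : Fin m → Fin N} {σ′} →
                   Covered σ σ′ (extVs as σ) (extVs bs σ′)
  covered-params {k} as bs {σ} {σ′} j = k ↑ʳ j , sym (extVs-↑ʳ as σ j) , sym (extVs-↑ʳ bs σ′ j)

  covered-args : ∀ {k m} (as : Vec (Fin N) k) bs {σ : Fin m → Fin N} {σ′} →
                 Covered (Vec.lookup as) (Vec.lookup bs) (extVs as σ) (extVs bs σ′)
  covered-args {m = m} as bs {σ} {σ′} j = j ↑ˡ m , sym (extVs-↑ˡ as σ j) , sym (extVs-↑ˡ bs σ′ j)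

  covered-extV : ∀ {m} {σ : Fin m → Fin N} {σ′} a b → Covered σ σ′ (extV a σ) (extV b σ′)
  covered-extV a b j = suc j , refl , refl

  covered-map : ∀ {k m} (ts : Vec (Fin m) k) {σ : Fin m → Fin N} {σ′} →
                Covered (extVs (Vec.map σ ts) σ) (extVs (Vec.map σ′ ts) σ′) σ σ′
  covered-map {k} ts {σ} {σ′} i with splitView k i
  ... | left j  = Vec.lookup ts j , trans (extVs-↑ˡ (Vec.map σ ts) σ j) (lookup-map j σ ts)
                                  , trans (extVs-↑ˡ (Vec.map σ′ ts) σ′ j) (lookup-map j σ′ ts)
  ... | right j = j , extVs-↑ʳ (Vec.map σ ts) σ j , extVs-↑ʳ (Vec.map σ′ ts) σ′ j

  RelIso-covered : ∀ {C m m′ k} {σ : Fin m → Fin N} {σ′} {τ : Fin m′ → Fin N} {τ′} {R : Rel N k} {R′} →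
                   Covered σ σ′ τ τ′ → RelIso C σ σ′ R R′ → RelIso C τ τ′ R R′
  RelIso-covered cov iso as bs p = iso as bs (PartialIso-covered (covered-extVs as bs cov) p)

module _ {N : ℕ} {C : List (Fin N)} {m : ℕ} {σ : Fin m → Fin N} {σ′ : Fin m → Fin (suc N)} where

  PartialIso-extV : ∀ {a b} → PartialIso C σ σ′ → Compatible C a b → (∀ j → a ≡ σ j ⇔ b ≡ σ′ j) →
                    PartialIso C (extV a σ) (extV b σ′)
  PartialIso-extV {a} {b} (compatible , injective) ab-compatible ab-injective = compatible′ , injective′
    where
    compatible′ : ∀ i → Compatible C (extV a σ i) (extV b σ′ i)
    compatible′ zero    = ab-compatible
    compatible′ (suc i) = compatible i
    injective′ : ∀ i j → extV a σ i ≡ extV a σ j ⇔ extV b σ′ i ≡ extV b σ′ j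
    injective′ zero    zero    = mk⇔ (λ _ → refl) (λ _ → refl)
    injective′ zero    (suc j) = ab-injective j
    injective′ (suc i) zero    = mk⇔ (sym ∘ Equivalence.to (ab-injective i) ∘ sym)
                                     (sym ∘ Equivalence.from (ab-injective i) ∘ sym)
    injective′ (suc i) (suc j) = injective i j

  -- Answer a by the partner of a if a is already named, by suc a if a ∈ C,
  -- and otherwise by a vertex not yet used on the right.
  forth : PartialIso C σ σ′ → length C + m < N → ∀ a → ∃ λ b → PartialIso C (extV a σ) (extV b σ′)
  forth iso@(compatible , injective) |C|+m<N a with Finₚ.any? (λ i → a Fin.≟ σ i)
  ... | yes (i , refl) = σ′ i , PartialIso-extV iso (compatible i) (injective i)
  ... | no a∉σ with a ∈? C
  ...   | yes a∈C = suc a , PartialIso-extV iso (const refl , λ _ → Finₚ.suc-injective)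
      λ j → absurd⇔ (a∉σ ∘ (j ,_)) (a∉σ ∘ (j ,_) ∘ sym ∘ proj₂ (compatible j) a∈C ∘ sym)
  ...   | no a∉C with fresh (suc N) (List.map suc C ++ List.tabulate σ′) room
    where
    room : length (List.map suc C ++ List.tabulate σ′) < suc N
    room = subst (_< suc N) (sym (trans (length-++ (List.map suc C)) (cong₂ _+_ (length-map suc C) (length-tabulate σ′))))
                 (m≤n⇒m≤1+n |C|+m<N)
  ...     | b , b∉ = b , PartialIso-extV iso (⊥-elim ∘ a∉C , λ c∈C → ⊥-elim ∘ b∉ ∘ ∈-++⁺ˡ ∘ ∈-map-≡ c∈C)
      λ j → absurd⇔ (a∉σ ∘ (j ,_)) (b∉ ∘ ∈-++⁺ʳ (List.map suc C) ∘ ∈-tabulate-≡ j)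

  back : PartialIso C σ σ′ → length C + m < N → ∀ b → ∃ λ a → PartialIso C (extV a σ) (extV b σ′)
  back iso@(compatible , injective) |C|+m<N b with Finₚ.any? (λ i → b Fin.≟ σ′ i)
  ... | yes (i , refl) = σ i , PartialIso-extV iso (compatible i) (injective i)
  ... | no b∉σ′ with b ∈? List.map suc C
  ...   | yes b∈sC with ∈-map⁻ suc b∈sC
  ...     | c , c∈C , refl = c , PartialIso-extV iso (const refl , λ _ → Finₚ.suc-injective)
      λ j → mk⇔ (λ c≡σj → sym (trans (proj₁ (compatible j) (subst (_∈ C) c≡σj c∈C)) (cong suc (sym c≡σj))))
                (⊥-elim ∘ b∉σ′ ∘ (j ,_))
  back iso@(compatible , injective) |C|+m<N b
      | no b∉σ′ | no b∉sC with fresh N (C ++ List.tabulate σ) room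
    where
    room : length (C ++ List.tabulate σ) < N
    room = subst (_< N) (sym (trans (length-++ C) (cong (length C +_) (length-tabulate σ)))) |C|+m<N
  ... | a , a∉ = a , PartialIso-extV iso (⊥-elim ∘ a∉ ∘ ∈-++⁺ˡ , λ c∈C → ⊥-elim ∘ b∉sC ∘ ∈-map-≡ c∈C)
      λ j → absurd⇔ (a∉ ∘ ∈-++⁺ʳ C ∘ ∈-tabulate-≡ j) (b∉σ′ ∘ (j ,_))

width : ∀ {Γ m} → Formula Γ m → ℕ
width {m = m} (edge x y)  = m
width {m = m} (equal x y) = m
width {m = m} (rel i xs)  = m
width (neg φ)      = width φ
width (conj φ ψ)   = width φ ⊔ width ψ
width (disj φ ψ)   = width φ ⊔ width ψ
width (exi φ)      = width φ
width (all' φ)     = width φ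
width (ifp k φ ts) = width φ

free≤width : ∀ {Γ m} (φ : Formula Γ m) → m ≤ width φ
free≤width (edge x y)   = ≤-refl
free≤width (equal x y)  = ≤-refl
free≤width (rel i xs)   = ≤-refl
free≤width (neg φ)      = free≤width φ
free≤width (conj φ ψ)   = ≤-trans (free≤width φ) (m≤m⊔n _ _)
free≤width (disj φ ψ)   = ≤-trans (free≤width φ) (m≤m⊔n _ _)
free≤width (exi φ)      = ≤-trans (n≤1+n _) (free≤width φ)
free≤width (all' φ)     = ≤-trans (n≤1+n _) (free≤width φ)
free≤width {m = m} (ifp k φ ts) = ≤-trans (m≤n+m m k) (free≤width φ)

emptyGraph : (N : ℕ) → Graph N
emptyGraph N _ _ = false

module _ {N : ℕ} (C : List (Fin N)) where

  private
    G₀ : Graph N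
    G₀ = emptyGraph N
    G₁ : Graph (suc N)
    G₁ = emptyGraph (suc N)

  fits-≤ : ∀ {v w} → v ≤ w → length C + w < N → length C + v < N
  fits-≤ v≤w = ≤-trans (s≤s (+-monoʳ-≤ (length C) v≤w))

  Agree : ∀ {Γ m} → Formula Γ m → Set
  Agree {Γ} φ = ∀ {ρ ρ′ σ σ′} → EnvIso C σ σ′ Γ ρ ρ′ → PartialIso C σ σ′ → eval G₀ φ ρ σ ≡ eval G₁ φ ρ′ σ′

  agree-equal : ∀ {Γ m} (x y : Fin m) → Agree {Γ} (equal x y)
  agree-equal x y {σ = σ} {σ′} _ (_ , injective) with σ x Fin.≟ σ y | σ′ x Fin.≟ σ′ y
  ... | yes _    | yes _     = refl
  ... | no  _    | no  _     = refl
  ... | yes σx≡σy | no σ′x≢σ′y = ⊥-elim (σ′x≢σ′y (Equivalence.to (injective x y) σx≡σy))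
  ... | no σx≢σy  | yes σ′x≡σ′y = ⊥-elim (σx≢σy (Equivalence.from (injective x y) σ′x≡σ′y))

  agree-rel : ∀ {Γ m} i (xs : Vec (Fin m) (List.lookup Γ i)) → Agree {Γ} (rel i xs)
  agree-rel {Γ} i xs env iso = env i _ _ (PartialIso-covered (covered-map {k = List.lookup Γ i} xs) iso)

  module _ {Γ m} {φ : Formula Γ (suc m)} (|C|+m<N : length C + m < N) (agree-φ : Agree φ)
           {ρ : RelEnv N Γ} {ρ′ : RelEnv (suc N) Γ} {σ : Fin m → Fin N} {σ′ : Fin m → Fin (suc N)}
           (env : EnvIso C σ σ′ Γ ρ ρ′) (iso : PartialIso C σ σ′) where

    private
      match-forth : ∀ {a} → a ∈ allFin N → ∃ λ b → b ∈ allFin (suc N) × eval G₀ φ ρ (extV a σ) ≡ eval G₁ φ ρ′ (extV b σ′)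
      match-forth {a} _ with forth iso |C|+m<N a
      ... | b , iso′ = b , ∈-allFin b , agree-φ (λ i → RelIso-covered (covered-extV a b) (env i)) iso′

      match-back : ∀ {b} → b ∈ allFin (suc N) → ∃ λ a → a ∈ allFin N × eval G₀ φ ρ (extV a σ) ≡ eval G₁ φ ρ′ (extV b σ′)
      match-back {b} _ with back iso |C|+m<N b
      ... | a , iso′ = a , ∈-allFin a , agree-φ (λ i → RelIso-covered (covered-extV a b) (env i)) iso′

    agree-exi : eval G₀ (exi φ) ρ σ ≡ eval G₁ (exi φ) ρ′ σ′
    agree-exi = any-≡ _ _ match-forth match-back

    agree-all : eval G₀ (all' φ) ρ σ ≡ eval G₁ (all' φ) ρ′ σ′
    agree-all = all-≡ _ _ match-forth match-back

  agree-ifp : ∀ {Γ m k} {φ : Formula (k ∷ Γ) (k + m)} (ts : Vec (Fin m) k) → Agree φ → Agree {Γ} (ifp k φ ts)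
  agree-ifp {Γ} {m} {k} {φ} ts agree-φ {ρ} {ρ′} {σ} {σ′} env iso = begin
    eval G₀ (ifp k φ ts) ρ σ
      ≡⟨ eval-ifp-stable G₀ φ ts ρ σ (^-monoˡ-≤ k (n≤1+n N)) ⟩
    stage₀ (suc N ^ k) (Vec.map σ ts)
      ≡⟨ stages-iso (suc N ^ k) (Vec.map σ ts) (Vec.map σ′ ts) (PartialIso-covered (covered-map ts) iso) ⟩
    eval G₁ (ifp k φ ts) ρ′ σ′
      ∎
    where
    open ≡-Reasoning
    stage₀ : ℕ → Rel N k
    stage₀ n = iterate (ifpStep G₀ φ ρ σ) n (λ _ → false)
    stage₁ : ℕ → Rel (suc N) k
    stage₁ n = iterate (ifpStep G₁ φ ρ′ σ′) n (λ _ → false)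
    stages-iso : ∀ n → RelIso C σ σ′ (stage₀ n) (stage₁ n)
    stages-iso zero    as bs iso′ = refl
    stages-iso (suc n) as bs iso′ = cong₂ _∨_ (stages-iso n as bs iso′) (agree-φ env′ iso′)
      where
      env′ : EnvIso C (extVs as σ) (extVs bs σ′) (k ∷ Γ) (extR (stage₀ n) ρ) (extR (stage₁ n) ρ′)
      env′ zero    = RelIso-covered (covered-params as bs) (stages-iso n)
      env′ (suc i) = RelIso-covered (covered-params as bs) (env i)

  agree : ∀ {Γ m} (φ : Formula Γ m) → length C + width φ < N → Agree φ
  agree (edge x y)   _ _ _ = refl
  agree {Γ} (equal x y) _ = agree-equal {Γ} x y
  agree {Γ} (rel i xs)  _ = agree-rel {Γ} i xs
  agree (neg φ)      fits env iso = cong not (agree φ fits env iso)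
  agree (conj φ ψ)   fits env iso =
    cong₂ _∧_ (agree φ (fits-≤ (m≤m⊔n _ _) fits) env iso) (agree ψ (fits-≤ (m≤n⊔m _ _) fits) env iso)
  agree (disj φ ψ)   fits env iso =
    cong₂ _∨_ (agree φ (fits-≤ (m≤m⊔n _ _) fits) env iso) (agree ψ (fits-≤ (m≤n⊔m _ _) fits) env iso)
  agree (exi φ)      fits env iso =
    agree-exi {φ = φ} (fits-≤ (≤-trans (n≤1+n _) (free≤width φ)) fits) (agree φ fits) env iso
  agree (all' φ)     fits env iso =
    agree-all {φ = φ} (fits-≤ (≤-trans (n≤1+n _) (free≤width φ)) fits) (agree φ fits) env iso
  agree (ifp k φ ts) fits         = agree-ifp {φ = φ} ts (agree φ fits)

liftRel-iso : ∀ {N k m} {C : List (Fin N)} (S : Rel N k) {σ : Fin m → Fin N} {σ′} →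
              (∀ {c} → c ∈ support S → c ∈ C) → RelIso C σ σ′ S (liftRel S)
liftRel-iso {C = C} S {σ} {σ′} support⊆C as bs iso = T-ext to from
  where
  compatible : ∀ i → Compatible C (Vec.lookup as i) (Vec.lookup bs i)
  compatible = proj₁ (PartialIso-covered (covered-args as bs) iso)
  to : T (S as) → T (liftRel S bs)
  to Sas = subst T (sym (trans (cong (liftRel S) bs≡sas) (liftRel-map-suc S as))) Sas
    where
    bs≡sas : bs ≡ Vec.map suc as
    bs≡sas = lookup-ext λ i → trans (proj₁ (compatible i) (support⊆C (∈-support S Sas i))) (sym (lookup-map i suc as))
  from : T (liftRel S bs) → T (S as)
  from Sbs with liftRel⁻ S bs Sbs
  ... | as′ , refl , Sas′ = subst (T ∘ S) (sym as≡as′) Sas′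
    where
    as≡as′ : as ≡ as′
    as≡as′ = lookup-ext λ i → proj₂ (compatible i) (support⊆C (∈-support S Sas′ i)) (lookup-map i suc as′)

budget : ∀ {Γ} → LogSOFormula Γ → ℕ → ℕ
budget (body ψ)        N = width ψ
budget (∃log ar k _ φ) N = ar * logᵏ k N + budget φ N

ClosedEnvIso : ∀ {N} → List (Fin N) → (Γ : List ℕ) → RelEnv N Γ → RelEnv (suc N) Γ → Set
ClosedEnvIso {N} C Γ ρ ρ′ = ∀ {σ : Fin 0 → Fin N} {σ′ : Fin 0 → Fin (suc N)} → EnvIso C σ σ′ Γ ρ ρ′

transfer : ∀ {N Γ} (φ : LogSOFormula Γ) (C : List (Fin N)) {ρ ρ′} → ClosedEnvIso C Γ ρ ρ′ →
           length C + budget φ N < N → Sat (emptyGraph N) φ ρ → Sat (emptyGraph (suc N)) φ ρ′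
transfer (body ψ) C env fits = subst T (agree C ψ fits env ((λ ()) , (λ ())))
transfer {N} {Γ} (∃log ar k _ φ) C {ρ} {ρ′} env fits (S , |S|≤ , sat) =
  liftRel S , |liftS|≤ , transfer φ (C ++ support S) env′ fits′ sat
  where
  |liftS|≤ : card (liftRel S) ≤ logᵏ k (suc N)
  |liftS|≤ = ≤-trans (≤-reflexive (card-liftRel S)) (≤-trans |S|≤ (^-monoˡ-≤ k (⌈log₂⌉-mono-≤ (n≤1+n N))))
  env′ : ClosedEnvIso (C ++ support S) (ar ∷ Γ) (extR S ρ) (extR (liftRel S) ρ′)
  env′ zero    = liftRel-iso S (∈-++⁺ʳ C)
  env′ (suc i) = λ as bs iso → env i as bs (PartialIso-⊆ ∈-++⁺ˡ iso)
  fits′ : length (C ++ support S) + budget φ N < N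
  fits′ = begin-strict
    length (C ++ support S) + budget φ N
      ≡⟨ cong (_+ budget φ N) (trans (length-++ C) (cong (length C +_) (length-support S))) ⟩
    length C + card S * ar + budget φ N
      ≤⟨ +-monoˡ-≤ (budget φ N) (+-monoʳ-≤ (length C) (≤-trans (≤-reflexive (*-comm (card S) ar))
                                                                 (*-monoʳ-≤ ar |S|≤))) ⟩
    length C + ar * logᵏ k N + budget φ N
      ≡⟨ +-assoc (length C) _ _ ⟩
    length C + (ar * logᵏ k N + budget φ N)
      <⟨ fits ⟩
    N ∎
    where open ≤-Reasoning

coefficient : ∀ {Γ} → LogSOFormula Γ → ℕ
coefficient (body ψ)        = width ψ
coefficient (∃log ar k _ φ) = ar + coefficient φ

degree : ∀ {Γ} → LogSOFormula Γ → ℕ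
degree (body ψ)        = 0
degree (∃log ar k _ φ) = k ⊔ degree φ

budget≤poly-log : ∀ {Γ} (φ : LogSOFormula Γ) N {K} → 1 ≤ ⌈log₂ N ⌉ → degree φ ≤ K →
                  budget φ N ≤ coefficient φ * ⌈log₂ N ⌉ ^ K
budget≤poly-log (body ψ) N {K} 1≤L _ =
  m≤m*n (width ψ) (⌈log₂ N ⌉ ^ K) {{m^n≢0 ⌈log₂ N ⌉ K {{>-nonZero 1≤L}}}}
budget≤poly-log (∃log ar k _ φ) N {K} 1≤L k⊔d≤K = begin
  ar * L ^ k + budget φ N
    ≤⟨ +-mono-≤ (*-monoʳ-≤ ar (^-monoʳ-≤ L {{>-nonZero 1≤L}} (≤-trans (m≤m⊔n k (degree φ)) k⊔d≤K)))
                (budget≤poly-log φ N 1≤L (≤-trans (m≤n⊔m k (degree φ)) k⊔d≤K)) ⟩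
  ar * L ^ K + coefficient φ * L ^ K
    ≡⟨ *-distribʳ-+ (L ^ K) ar (coefficient φ) ⟨
  (ar + coefficient φ) * L ^ K ∎
  where
  open ≤-Reasoning
  L : ℕ
  L = ⌈log₂ N ⌉

n<2^n : ∀ n → n < 2 ^ n
n<2^n zero    = s≤s z≤n
n<2^n (suc n) = begin-strict
  suc n          ≡⟨ +-comm 1 n ⟩
  n + 1          <⟨ +-mono-<-≤ (n<2^n n) (m^n>0 2 n) ⟩
  2 ^ n + 2 ^ n  ≡⟨ cong (2 ^ n +_) (+-identityʳ (2 ^ n)) ⟨
  2 ^ suc n      ∎
  where open ≤-Reasoning

linear<exp : ∀ A K → ∃ λ s → A + s * K < 2 ^ s
linear<exp A K = s , (begin-strict
    A + s * K
      ≤⟨ +-monoˡ-≤ (s * K) (m≤m*n A s) ⟩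
    A * s + s * K
      ≡⟨ cong (A * s +_) (*-comm s K) ⟩
    A * s + K * s
      ≡⟨ *-distribʳ-+ s A K ⟨
    M * s
      <⟨ *-monoˡ-< s (n<2^n M) ⟩
    2 ^ M * s
      ≡⟨ ^-distribˡ-+-* 2 M (suc M) ⟨
    2 ^ (M + suc M)
      ≤⟨ ^-monoʳ-≤ 2 M+1+M≤s ⟩
    2 ^ s ∎)
  where
  open ≤-Reasoning
  M s : ℕ
  M = A + K
  s = 2 ^ suc M
  instance
    s≢0 : NonZero s
    s≢0 = m^n≢0 2 (suc M)
  M+1+M≤s : M + suc M ≤ s
  M+1+M≤s = begin
    M + suc M      ≡⟨ +-comm M (suc M) ⟩
    suc M + M      ≤⟨ +-mono-≤ (n<2^n M) (<⇒≤ (n<2^n M)) ⟩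
    2 ^ M + 2 ^ M  ≡⟨ cong (2 ^ M +_) (+-identityʳ (2 ^ M)) ⟨
    s ∎

poly<exp : ∀ A K → ∃ λ t → 1 ≤ t × A * t ^ K < 2 ^ t
poly<exp A K with linear<exp A K
... | s , A+sK<2^s = 2 ^ s , m^n>0 2 s , (begin-strict
    A * (2 ^ s) ^ K
      ≡⟨ cong (A *_) (^-*-assoc 2 s K) ⟩
    A * 2 ^ (s * K)
      ≤⟨ *-monoˡ-≤ (2 ^ (s * K)) (<⇒≤ (n<2^n A)) ⟩
    2 ^ A * 2 ^ (s * K)
      ≡⟨ ^-distribˡ-+-* 2 A (s * K) ⟨
    2 ^ (A + s * K)
      <⟨ ^-monoʳ-< 2 (s≤s (s≤s z≤n)) A+sK<2^s ⟩
    2 ^ 2 ^ s ∎)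
  where open ≤-Reasoning

small-budget-at-even-size : ∀ {Γ} (φ : LogSOFormula Γ) → ∃ λ n → 2 ∣ suc n × budget φ (suc n) < suc n
small-budget-at-even-size φ with poly<exp (coefficient φ) (degree φ)
... | suc t , _ , small = as-successor (m^n>0 2 (suc t)) (divides (2 ^ t) (*-comm 2 (2 ^ t))) fits
  where
  log≡ : ⌈log₂ 2 ^ suc t ⌉ ≡ suc t
  log≡ = ⌈log₂2^n⌉≡n (suc t)
  fits : budget φ (2 ^ suc t) < 2 ^ suc t
  fits = ≤-<-trans (budget≤poly-log φ (2 ^ suc t) (subst (1 ≤_) (sym log≡) (s≤s z≤n)) ≤-refl)
                   (subst (λ L → coefficient φ * L ^ degree φ < 2 ^ suc t) (sym log≡) small)
  as-successor : ∀ {N} → 0 < N → 2 ∣ N → budget φ N < N → ∃ λ n → 2 ∣ suc n × budget φ (suc n) < suc n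
  as-successor {suc n} _ even fits = n , even , fits

2∣n⇒2∤1+n : ∀ {n} → 2 ∣ n → ¬ 2 ∣ suc n
2∣n⇒2∤1+n {n} 2∣n 2∣1+n = <⇒≱ (s≤s (s≤s z≤n)) (∣⇒≤ (∣m+n∣m⇒∣n (subst (2 ∣_) (+-comm 1 n) 2∣1+n) 2∣n))

theorem4p1 : ¬ Σ Sentence (λ φ →
               (n : ℕ) (G : Graph (suc n)) → (G ⊨ φ) ⇔ (2 ∣ suc n))
theorem4p1 (φ , defines-even) with small-budget-at-even-size φ
... | n , even , fits = 2∣n⇒2∤1+n even (Equivalence.to (defines-even (suc n) (emptyGraph (suc (suc n)))) odd⊨φ)
  where
  even⊨φ : emptyGraph (suc n) ⊨ φ
  even⊨φ = Equivalence.from (defines-even n (emptyGraph (suc n))) even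
  odd⊨φ : emptyGraph (suc (suc n)) ⊨ φ
  odd⊨φ = transfer φ [] (λ ()) fits even⊨φ
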